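{- For every integer $n\ge 1$, the path $P_n$ on $n$ vertices satisfies $st_{id}(P_n)=2$ if $n\equiv 2 \pmod 3$, and $st_{id}(P_n)=1$ otherwise.
   Context: All graphs are finite and simple. An independent dominating set of a graph $G$ is a set $S\subseteq V(G)$ of pairwise non-adjacent vertices such that every vertex not in $S$ has a neighbour in $S$. The independent domination number $\gamma_i(G)$ is the minimum size of an independent dominating set (for the null graph with no vertices, $\gamma_i=0$). The independent domination stability $st_{id}(G)$ is the minimum number of vertices whose removal from $G$ yields a graph with independent domination number different from $\gamma_i(G)$. -}

module Defs where

open import Data.Nat using (ℕ; suc; _≤_)
open import Data.Fin using (Fin; toℕ)
open import Data.Fin.Subset using (Subset; _∈_; _∉_; _⊆_; ∁; ⊤; ∣_∣)
open import Data.Product using (Σ; ∃; _×_)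
open import Data.Sum using (_⊎_)
open import Relation.Nullary using (¬_)
open import Relation.Binary.PropositionalEquality using (_≡_; _≢_)

record Graph (n : ℕ) : Set₁ where
  field
    Adj   : Fin n → Fin n → Set
    sym   : ∀ {u v} → Adj u v → Adj v u
    irrefl : ∀ {v} → ¬ Adj v v
open Graph public

-- Everything below concerns the induced subgraph G[U] for a vertex set U.
-- Removing a vertex set X from G gives G[∁ X]; G itself is G[⊤].

IsIDS : ∀ {n} → Graph n → Subset n → Subset n → Set
IsIDS G U S =
  S ⊆ U
  × (∀ {u v} → u ∈ S → v ∈ S → ¬ Adj G u v)
  × (∀ v → v ∈ U → v ∉ S → ∃ λ u → u ∈ S × Adj G u v)

IsIndDomNum : ∀ {n} → Graph n → Subset n → ℕ → Set
IsIndDomNum G U k =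
  (∃ λ S → IsIDS G U S × ∣ S ∣ ≡ k)
  × (∀ S → IsIDS G U S → k ≤ ∣ S ∣)

ChangesIndDom : ∀ {n} → Graph n → Subset n → Set
ChangesIndDom G X = ∀ a b → IsIndDomNum G ⊤ a → IsIndDomNum G (∁ X) b → a ≢ b

IsIndDomStab : ∀ {n} → Graph n → ℕ → Set
IsIndDomStab G r =
  (∃ λ X → ∣ X ∣ ≡ r × ChangesIndDom G X)
  × (∀ X → ChangesIndDom G X → r ≤ ∣ X ∣)

PathAdj : ∀ {n} → Fin n → Fin n → Set
PathAdj i j = (toℕ j ≡ suc (toℕ i)) ⊎ (toℕ i ≡ suc (toℕ j))

private
  open import Data.Sum using (inj₁; inj₂)
  open import Data.Nat.Properties using (<-irrefl; n<1+n)
  open import Relation.Binary.PropositionalEquality using () renaming (sym to ≡-sym)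
  pathSym : ∀ {n} {u v : Fin n} → PathAdj u v → PathAdj v u
  pathSym (inj₁ e) = inj₂ e
  pathSym (inj₂ e) = inj₁ e
  pathIrr : ∀ {n} {v : Fin n} → ¬ PathAdj v v
  pathIrr (inj₁ e) = <-irrefl e (n<1+n _)
  pathIrr (inj₂ e) = <-irrefl e (n<1+n _)

Path : (n : ℕ) → Graph n
Path n = record { Adj = PathAdj ; sym = pathSym ; irrefl = pathIrr }

-- On a path a chosen vertex dominates at most three vertices, so γ_i(P_n − Y) ≥ (n − |Y|)/3;
-- conversely P_n − Y has at most |Y| + 1 segments, and choosing ⌈ℓ/3⌉ vertices on a segment of
-- length ℓ gives γ_i(P_n − Y) ≤ (n + |Y| + 2)/3. For Y = ∅, and for |Y| ≤ 1 when n ≡ 2 (mod 3),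
-- the two bounds pin γ_i(P_n − Y) down to ⌈n/3⌉. Deleting the first two vertices of P_{3k+2} or
-- the first vertex of P_{3k+1} leaves P_{3k}, with γ_i = k, and deleting the second vertex of
-- P_{3k+3} isolates the first one beside a P_{3k+1}, giving γ_i = k + 2.
module Submission where

open import Defs
open import Data.Nat using (ℕ; _≥_)
open import Data.Nat.DivMod using (_%_)
open import Data.Product using (_×_)
open import Relation.Nullary using (¬_)
open import Relation.Binary.PropositionalEquality using (_≡_)

open import Data.Bool using (Bool; true; false; not; _∧_; _∨_; if_then_else_; T)
open import Data.Bool.Properties using (¬-not)
open import Data.Empty using (⊥-elim)
open import Data.Fin using (Fin; toℕ; zero; suc)
open import Data.Fin.Subset using (Subset; _∈_; _∉_; _⊆_; ∁; ⊤; ⊥; ∣_∣)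
open import Data.Fin.Subset.Properties using (∣⊥∣≡0; ∣∁p∣≡n∸∣p∣; ∣p∣≤n; ∪-identityˡ; ∪-inverseʳ)
open import Data.Nat using (zero; suc; _+_; _*_; _≤_; z≤n; s≤s; _≤?_)
open import Data.Nat.DivMod using (_/_; m≡m%n+[m/n]*n; m%n<n)
open import Data.Nat.Properties
open import Data.Product using (∃; _,_; proj₂)
open import Data.Sum using (_⊎_; inj₁; inj₂)
open import Data.Unit using (tt) renaming (⊤ to Unit)
open import Data.Vec using (Vec; []; _∷_; here; there)
open import Function using (_∘_; case_of_)
open import Relation.Nullary.Decidable using (decidable-stable)
open import Relation.Binary.PropositionalEquality using (_≢_; refl; trans; cong; subst) renaming (sym to ≡-sym)

indDomNum-unique : ∀ {n a b} (G : Graph n) {U : Subset n} →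
  IsIndDomNum G U a → IsIndDomNum G U b → a ≡ b
indDomNum-unique G ((S , S-ids , refl) , S-min) ((T , T-ids , refl) , T-min) =
  ≤-antisym (S-min T T-ids) (T-min S S-ids)

∁⊥≡⊤ : ∀ {n} → ∁ (⊥ {n}) ≡ ⊤
∁⊥≡⊤ = trans (≡-sym (∪-identityˡ (∁ ⊥))) (∪-inverseʳ ⊥)

isIndDomStab : ∀ {n r a b} (G : Graph n) (X : Subset n) →
  (∀ Y → ∣ Y ∣ ≤ r → IsIndDomNum G (∁ Y) a) →
  ∣ X ∣ ≡ suc r → IsIndDomNum G (∁ X) b → a ≢ b → IsIndDomStab G (suc r)
isIndDomStab {n} {r} {a} G X robust ∣X∣≡1+r γX a≢b = (X , ∣X∣≡1+r , changes) , minimal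
  where
  γ⊤ : IsIndDomNum G ⊤ a
  γ⊤ = subst (λ U → IsIndDomNum G U a) ∁⊥≡⊤ (robust ⊥ (≤-trans (≤-reflexive (∣⊥∣≡0 n)) z≤n))
  changes : ChangesIndDom G X
  changes a′ b′ γ⊤′ γX′ a′≡b′ =
    a≢b (trans (indDomNum-unique G γ⊤ γ⊤′) (trans a′≡b′ (indDomNum-unique G γX′ γX)))
  minimal : ∀ Y → ChangesIndDom G Y → suc r ≤ ∣ Y ∣
  minimal Y changesY = decidable-stable (suc r ≤? ∣ Y ∣)
    (λ r≰Y → changesY a a γ⊤ (robust Y (≤-pred (≰⇒> r≰Y))) refl)

at : ∀ {n} → Vec Bool n → ℕ → Bool
at []      _       = false
at (b ∷ _) zero    = b
at (_ ∷ v) (suc m) = at v m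

∈⇒at : ∀ {n} {i : Fin n} {p : Subset n} → i ∈ p → at p (toℕ i) ≡ true
∈⇒at here        = refl
∈⇒at (there i∈p) = ∈⇒at i∈p

at-toℕ⇒∈ : ∀ {n} (p : Subset n) (i : Fin n) → at p (toℕ i) ≡ true → i ∈ p
at-toℕ⇒∈ (_ ∷ _) zero    refl = here
at-toℕ⇒∈ (_ ∷ p) (suc i) e    = there (at-toℕ⇒∈ p i e)

at⇒∈ : ∀ {n} (p : Subset n) m → at p m ≡ true → ∃ λ i → toℕ i ≡ m × i ∈ p
at⇒∈ []      m       ()
at⇒∈ (_ ∷ _) zero    refl = zero , refl , here
at⇒∈ (_ ∷ p) (suc m) e with at⇒∈ p m e
... | i , refl , i∈p = suc i , refl , there i∈p

-- The condition at one vertex: u and s say whether it lies in U and in S,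
-- ps and ns whether its left and right neighbours lie in S.
locallyIDS : (ps u s ns : Bool) → Bool
locallyIDS ps u s ns = if s then not ps ∧ u else (not u ∨ ps ∨ ns)

record LocallyIDS (ps u s ns : Bool) : Set where
  field
    selected⇒present : s ≡ true → u ≡ true
    independent      : ps ≡ true → s ≢ true
    dominated        : u ≡ true → s ≡ false → ps ≡ true ⊎ ns ≡ true
open LocallyIDS

locallyIDS-sound : ∀ ps u s ns → T (locallyIDS ps u s ns) → LocallyIDS ps u s ns
locallyIDS-sound false true  true  ns _ =
  record { selected⇒present = λ _ → refl ; independent = λ () ; dominated = λ _ () }
locallyIDS-sound ps    false false ns _ =
  record { selected⇒present = λ () ; independent = λ _ () ; dominated = λ () }
locallyIDS-sound true  true  false ns _ =
  record { selected⇒present = λ () ; independent = λ _ () ; dominated = λ _ _ → inj₁ refl }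
locallyIDS-sound false true  false true _ =
  record { selected⇒present = λ () ; independent = λ _ () ; dominated = λ _ _ → inj₂ refl }
locallyIDS-sound false true  false false ()
locallyIDS-sound false false true  ns    ()
locallyIDS-sound true  u     true  ns    ()

locallyIDS-complete : ∀ ps u s ns → LocallyIDS ps u s ns → T (locallyIDS ps u s ns)
locallyIDS-complete ps    false false ns l = tt
locallyIDS-complete true  true  false ns l = tt
locallyIDS-complete false true  false ns l with dominated l refl refl
... | inj₂ refl = tt
locallyIDS-complete false true  true  ns l = tt
locallyIDS-complete false false true  ns l = case selected⇒present l refl of λ ()
locallyIDS-complete true  u     true  ns l = ⊥-elim (independent l refl refl)

-- PathIDS ps U S: S is an independent dominating set of the path restricted to U,
-- where an extra vertex to the left of position 0 belongs to S iff ps.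
PathIDS : ∀ {n} → Bool → Vec Bool n → Vec Bool n → Set
PathIDS ps []      []      = Unit
PathIDS ps (u ∷ U) (s ∷ S) = T (locallyIDS ps u s (at S 0)) × PathIDS s U S

pathIDS⇒pointwise : ∀ {n ps} {U S : Vec Bool n} → PathIDS ps U S →
  ∀ m → T (locallyIDS (at (ps ∷ S) m) (at U m) (at S m) (at S (suc m)))
pathIDS⇒pointwise {U = []}    {[]}    _       m       = tt
pathIDS⇒pointwise {U = _ ∷ _} {_ ∷ _} (t , _) zero    = t
pathIDS⇒pointwise {U = _ ∷ _} {_ ∷ _} (_ , p) (suc m) = pathIDS⇒pointwise p m

pointwise⇒pathIDS : ∀ {n ps} {U S : Vec Bool n} →
  (∀ m → T (locallyIDS (at (ps ∷ S) m) (at U m) (at S m) (at S (suc m)))) → PathIDS ps U S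
pointwise⇒pathIDS {U = []}    {[]}    _ = tt
pointwise⇒pathIDS {U = _ ∷ _} {_ ∷ _} p = p zero , pointwise⇒pathIDS (p ∘ suc)

isIDS⇒locallyIDS : ∀ {n} {U S : Subset n} → IsIDS (Path n) U S →
  ∀ m → LocallyIDS (at (false ∷ S) m) (at U m) (at S m) (at S (suc m))
isIDS⇒locallyIDS {U = U} {S} (S⊆U , S-independent , S-dominating) m = record
  { selected⇒present = present ; independent = apart ; dominated = covered }
  where
  present : at S m ≡ true → at U m ≡ true
  present e with at⇒∈ S m e
  ... | i , refl , i∈S = ∈⇒at (S⊆U i∈S)
  apart : at (false ∷ S) m ≡ true → at S m ≢ true
  apart e f with at⇒∈ (false ∷ S) m e | at⇒∈ S m f
  ... | suc i , refl , there i∈S | j , j≡1+i , j∈S = S-independent i∈S j∈S (inj₁ j≡1+i)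
  covered : at U m ≡ true → at S m ≡ false → at (false ∷ S) m ≡ true ⊎ at S (suc m) ≡ true
  covered e f with at⇒∈ U m e
  ... | j , refl , j∈U with S-dominating j j∈U (λ j∈S → case trans (≡-sym f) (∈⇒at j∈S) of λ ())
  ...   | i , i∈S , inj₁ j≡1+i rewrite j≡1+i = inj₁ (∈⇒at i∈S)
  ...   | i , i∈S , inj₂ i≡1+j = inj₂ (subst (λ k → at S k ≡ true) i≡1+j (∈⇒at i∈S))

locallyIDS⇒isIDS : ∀ {n} {U S : Subset n} →
  (∀ m → LocallyIDS (at (false ∷ S) m) (at U m) (at S m) (at S (suc m))) → IsIDS (Path n) U S
locallyIDS⇒isIDS {U = U} {S} local = S⊆U , S-independent , S-dominating
  where
  S⊆U : S ⊆ U
  S⊆U {i} i∈S = at-toℕ⇒∈ U i (selected⇒present (local (toℕ i)) (∈⇒at i∈S))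
  S-independent : ∀ {i j} → i ∈ S → j ∈ S → ¬ PathAdj i j
  S-independent {i} {j} i∈S j∈S (inj₁ j≡1+i) = independent (local (toℕ j))
    (subst (λ k → at (false ∷ S) k ≡ true) (≡-sym j≡1+i) (∈⇒at i∈S)) (∈⇒at j∈S)
  S-independent i∈S j∈S (inj₂ i≡1+j) = S-independent j∈S i∈S (inj₁ i≡1+j)
  S-dominating : ∀ j → j ∈ U → j ∉ S → ∃ λ i → i ∈ S × PathAdj i j
  S-dominating j j∈U j∉S
    with dominated (local (toℕ j)) (∈⇒at j∈U) (¬-not (j∉S ∘ at-toℕ⇒∈ S j))
  ... | inj₁ e with at⇒∈ (false ∷ S) (toℕ j) e
  ...   | suc i , 1+i≡j , there i∈S = i , i∈S , inj₁ (≡-sym 1+i≡j)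
  S-dominating j j∈U j∉S | inj₂ e with at⇒∈ S (suc (toℕ j)) e
  ...   | i , i≡1+j , i∈S = i , i∈S , inj₂ i≡1+j

isIDS⇒pathIDS : ∀ {n} {U S : Subset n} → IsIDS (Path n) U S → PathIDS false U S
isIDS⇒pathIDS ids = pointwise⇒pathIDS (λ m → locallyIDS-complete _ _ _ _ (isIDS⇒locallyIDS ids m))

pathIDS⇒isIDS : ∀ {n} {U S : Subset n} → PathIDS false U S → IsIDS (Path n) U S
pathIDS⇒isIDS p = locallyIDS⇒isIDS (λ m → locallyIDS-sound _ _ _ _ (pathIDS⇒pointwise p m))

∣x∷p∣≤1+∣p∣ : ∀ {n} x (p : Subset n) → ∣ x ∷ p ∣ ≤ suc ∣ p ∣
∣x∷p∣≤1+∣p∣ true  p = ≤-refl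
∣x∷p∣≤1+∣p∣ false p = n≤1+n ∣ p ∣

∣p∣+∣∁p∣≡n : ∀ {n} (p : Subset n) → ∣ p ∣ + ∣ ∁ p ∣ ≡ n
∣p∣+∣∁p∣≡n p = trans (cong (∣ p ∣ +_) (∣∁p∣≡n∸∣p∣ p)) (m+[n∸m]≡n (∣p∣≤n p))

m*3≤2+n*3⇒m≤n : ∀ m n → m * 3 ≤ 2 + n * 3 → m ≤ n
m*3≤2+n*3⇒m≤n m n h = ≤-pred (*-cancelʳ-< 3 m (suc n) (s≤s h))

pathIDS-size : ∀ {n} {U S : Vec Bool n} → PathIDS false U S → ∣ U ∣ ≤ ∣ S ∣ * 3
pathIDS-size-after-selected : ∀ {n} {U S : Vec Bool n} → PathIDS true U S → ∣ U ∣ ≤ suc (∣ S ∣ * 3)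

pathIDS-size {U = []} {[]} _ = z≤n
pathIDS-size {U = u ∷ U} {true ∷ S} (_ , p) =
  ≤-trans (∣x∷p∣≤1+∣p∣ u U) (s≤s (m≤n⇒m≤1+n (pathIDS-size-after-selected p)))
pathIDS-size {U = false ∷ U} {false ∷ S} (_ , p) = pathIDS-size p
pathIDS-size {U = true ∷ u ∷ U} {false ∷ true ∷ S} (_ , _ , p) =
  s≤s (≤-trans (∣x∷p∣≤1+∣p∣ u U) (s≤s (pathIDS-size-after-selected p)))
pathIDS-size {U = true ∷ []} {false ∷ []} (() , _)
pathIDS-size {U = true ∷ _ ∷ _} {false ∷ false ∷ _} (() , _)

pathIDS-size-after-selected {U = []} {[]} _ = z≤n
pathIDS-size-after-selected {U = false ∷ U} {false ∷ S} (_ , p) = m≤n⇒m≤1+n (pathIDS-size p)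
pathIDS-size-after-selected {U = true ∷ U} {false ∷ S} (_ , p) = s≤s (pathIDS-size p)
pathIDS-size-after-selected {U = _ ∷ _} {true ∷ _} (() , _)

isIDS-size : ∀ {n} {U S : Subset n} → IsIDS (Path n) U S → ∣ U ∣ ≤ ∣ S ∣ * 3
isIDS-size = pathIDS-size ∘ isIDS⇒pathIDS

greedy : ∀ {n} → Vec Bool n → Vec Bool n
greedy []                         = []
greedy (false ∷ U)                = false ∷ greedy U
greedy (true ∷ [])                = true ∷ []
greedy (true ∷ false ∷ U)         = true ∷ false ∷ greedy U
greedy (true ∷ true ∷ [])         = true ∷ false ∷ []
greedy (true ∷ true ∷ false ∷ U)  = false ∷ true ∷ false ∷ greedy U
greedy (true ∷ true ∷ true ∷ U)   = false ∷ true ∷ false ∷ greedy U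

greedy-pathIDS : ∀ {n} (U : Vec Bool n) → PathIDS false U (greedy U)
greedy-pathIDS []                        = tt
greedy-pathIDS (false ∷ U)               = tt , greedy-pathIDS U
greedy-pathIDS (true ∷ [])               = tt , tt
greedy-pathIDS (true ∷ false ∷ U)        = tt , tt , greedy-pathIDS U
greedy-pathIDS (true ∷ true ∷ [])        = tt , tt , tt
greedy-pathIDS (true ∷ true ∷ false ∷ U) = tt , tt , tt , greedy-pathIDS U
greedy-pathIDS (true ∷ true ∷ true ∷ U)  = tt , tt , tt , greedy-pathIDS U

-- Each removed vertex ends at most one segment, and a segment of length ℓ receives ⌈ℓ/3⌉ ≤ (ℓ + 2)/3 vertices.
greedy-size : ∀ {n} (Y : Subset n) → ∣ greedy (∁ Y) ∣ * 3 ≤ 2 + (n + ∣ Y ∣)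
greedy-size []                         = z≤n
greedy-size {suc n} (true ∷ Y)         =
  ≤-trans (greedy-size Y) (≤-trans (m≤n+m _ 2) (≤-reflexive (cong (3 +_) (≡-sym (+-suc n ∣ Y ∣)))))
greedy-size (false ∷ [])               = ≤-refl
greedy-size {suc (suc n)} (false ∷ true ∷ Y) =
  s≤s (s≤s (s≤s (≤-trans (greedy-size Y) (≤-reflexive (cong (1 +_) (≡-sym (+-suc n ∣ Y ∣)))))))
greedy-size (false ∷ false ∷ [])       = s≤s (s≤s (s≤s z≤n))
greedy-size {suc (suc (suc n))} (false ∷ false ∷ true ∷ Y) =
  s≤s (s≤s (s≤s (≤-trans (greedy-size Y) (≤-trans (n≤1+n _) (≤-reflexive (cong (2 +_) (≡-sym (+-suc n ∣ Y ∣))))))))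
greedy-size (false ∷ false ∷ false ∷ Y) = s≤s (s≤s (s≤s (greedy-size Y)))

indDomNum-removal : ∀ {n v} (Y : Subset n) →
  ∣ Y ∣ + v * 3 ≤ 2 + n → ∣ Y ∣ + n ≤ v * 3 → IsIndDomNum (Path n) (∁ Y) v
indDomNum-removal {n} {v} Y lower upper =
  (greedy (∁ Y) , greedy-ids , ≤-antisym greedy≤v (minimal _ greedy-ids)) , minimal
  where
  open ≤-Reasoning
  greedy-ids : IsIDS (Path n) (∁ Y) (greedy (∁ Y))
  greedy-ids = pathIDS⇒isIDS (greedy-pathIDS (∁ Y))
  minimal : ∀ S → IsIDS (Path n) (∁ Y) S → v ≤ ∣ S ∣
  minimal S ids = m*3≤2+n*3⇒m≤n v ∣ S ∣ (+-cancelˡ-≤ ∣ Y ∣ _ _ (begin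
    ∣ Y ∣ + v * 3            ≤⟨ lower ⟩
    2 + n                    ≡⟨ cong (2 +_) (≡-sym (∣p∣+∣∁p∣≡n Y)) ⟩
    2 + (∣ Y ∣ + ∣ ∁ Y ∣)     ≤⟨ +-monoʳ-≤ (2 + ∣ Y ∣) (isIDS-size ids) ⟩
    2 + (∣ Y ∣ + ∣ S ∣ * 3)   ≡⟨ ≡-sym (trans (+-suc ∣ Y ∣ _) (cong suc (+-suc ∣ Y ∣ _))) ⟩
    ∣ Y ∣ + (2 + ∣ S ∣ * 3)   ∎))
  greedy≤v : ∣ greedy (∁ Y) ∣ ≤ v
  greedy≤v = m*3≤2+n*3⇒m≤n _ v (begin
    ∣ greedy (∁ Y) ∣ * 3 ≤⟨ greedy-size Y ⟩
    2 + (n + ∣ Y ∣)      ≡⟨ cong (2 +_) (+-comm n ∣ Y ∣) ⟩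
    2 + (∣ Y ∣ + n)      ≤⟨ +-monoʳ-≤ 2 upper ⟩
    2 + v * 3            ∎)

indDomNum-path : ∀ {n v} → v * 3 ≤ 2 + n → n ≤ v * 3 → IsIndDomNum (Path n) (∁ ⊥) v
indDomNum-path {n} {v} lower upper = indDomNum-removal ⊥
  (subst (λ y → y + v * 3 ≤ 2 + n) (≡-sym (∣⊥∣≡0 n)) lower)
  (subst (λ y → y + n ≤ v * 3) (≡-sym (∣⊥∣≡0 n)) upper)

indDomNum-false∷ : ∀ {n v} {U : Subset n} →
  IsIndDomNum (Path n) U v → IsIndDomNum (Path (suc n)) (false ∷ U) v
indDomNum-false∷ {n} {U = U} ((S , ids , refl) , minimal) =
  (false ∷ S , pathIDS⇒isIDS (tt , isIDS⇒pathIDS ids) , refl) , minimal′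
  where
  minimal′ : ∀ S′ → IsIDS (Path (suc n)) (false ∷ U) S′ → ∣ S ∣ ≤ ∣ S′ ∣
  minimal′ (false ∷ S′) ids′ = minimal S′ (pathIDS⇒isIDS (proj₂ (isIDS⇒pathIDS ids′)))
  minimal′ (true ∷ S′) ids′ with isIDS⇒pathIDS ids′
  ... | () , _

-- An isolated first vertex must itself be chosen.
indDomNum-true∷false∷ : ∀ {n v} {U : Subset n} →
  IsIndDomNum (Path n) U v → IsIndDomNum (Path (2 + n)) (true ∷ false ∷ U) (suc v)
indDomNum-true∷false∷ {n} {U = U} ((S , ids , refl) , minimal) =
  (true ∷ false ∷ S , pathIDS⇒isIDS (tt , tt , isIDS⇒pathIDS ids) , refl) , minimal′
  where
  minimal′ : ∀ S′ → IsIDS (Path (2 + n)) (true ∷ false ∷ U) S′ → suc ∣ S ∣ ≤ ∣ S′ ∣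
  minimal′ (true ∷ false ∷ S′) ids′ with isIDS⇒pathIDS ids′
  ... | _ , _ , p = s≤s (minimal S′ (pathIDS⇒isIDS p))
  minimal′ (false ∷ false ∷ S′) ids′ with isIDS⇒pathIDS ids′
  ... | () , _
  minimal′ (true ∷ true ∷ S′) ids′ with isIDS⇒pathIDS ids′
  ... | _ , () , _
  minimal′ (false ∷ true ∷ S′) ids′ with isIDS⇒pathIDS ids′
  ... | _ , () , _

stab-path-2+k*3 : ∀ k → IsIndDomStab (Path (2 + k * 3)) 2
stab-path-2+k*3 k = isIndDomStab (Path _) (true ∷ true ∷ ⊥)
  (λ Y ∣Y∣≤1 → indDomNum-removal Y (+-monoˡ-≤ (suc k * 3) ∣Y∣≤1) (+-monoˡ-≤ (2 + k * 3) ∣Y∣≤1))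
  (cong (2 +_) (∣⊥∣≡0 (k * 3)))
  (indDomNum-false∷ (indDomNum-false∷ (indDomNum-path {v = k} (m≤n+m _ 2) ≤-refl)))
  1+n≢n

stab-path-1+k*3 : ∀ k → IsIndDomStab (Path (1 + k * 3)) 1
stab-path-1+k*3 k = isIndDomStab (Path _) (true ∷ ⊥)
  (λ Y ∣Y∣≤0 → indDomNum-removal Y (+-monoˡ-≤ (suc k * 3) ∣Y∣≤0)
                 (≤-trans (+-monoˡ-≤ (1 + k * 3) ∣Y∣≤0) (m≤n+m _ 2)))
  (cong suc (∣⊥∣≡0 (k * 3)))
  (indDomNum-false∷ (indDomNum-path {v = k} (m≤n+m _ 2) ≤-refl))
  1+n≢n

stab-path-3+k*3 : ∀ k → IsIndDomStab (Path (3 + k * 3)) 1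
stab-path-3+k*3 k = isIndDomStab (Path _) (false ∷ true ∷ ⊥)
  (λ Y ∣Y∣≤0 → indDomNum-removal Y (≤-trans (+-monoˡ-≤ (suc k * 3) ∣Y∣≤0) (m≤n+m _ 2))
                 (+-monoˡ-≤ (3 + k * 3) ∣Y∣≤0))
  (cong suc (∣⊥∣≡0 (1 + k * 3)))
  (indDomNum-true∷false∷ (indDomNum-path {v = suc k} ≤-refl (m≤n+m _ 2)))
  (1+n≢n ∘ ≡-sym)

mainTheorem3 : ∀ (n : ℕ) → n ≥ 1 →
    (n % 3 ≡ 2 → IsIndDomStab (Path n) 2)
    × (¬ (n % 3 ≡ 2) → IsIndDomStab (Path n) 1)
mainTheorem3 n n≥1 with n % 3 | n / 3 | m≡m%n+[m/n]*n n 3 | m%n<n n 3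
... | 2 | k     | refl | _ = (λ _ → stab-path-2+k*3 k) , λ 2≢2 → ⊥-elim (2≢2 refl)
... | 1 | k     | refl | _ = (λ ()) , λ _ → stab-path-1+k*3 k
... | 0 | suc k | refl | _ = (λ ()) , λ _ → stab-path-3+k*3 k
mainTheorem3 .0 () | 0 | zero | refl | _
mainTheorem3 n n≥1 | suc (suc (suc _)) | _ | _ | s≤s (s≤s (s≤s ()))
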